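{- Let $((A,\to),\mathrm{obs})$ be a QARS satisfying the Limit Property: for all $t,s\in A$, if $\mathbf p\in\mathrm{Lim}_{\mathrm{obs}}(t)$ and $t\to^*s$, then there is $\mathbf q\in\mathrm{Lim}_{\mathrm{obs}}(t)$ with $\mathbf p\le\mathbf q$ such that some maximal $\to$-sequence $\langle s_n\rangle$ from $s$ has $\sup_n\mathrm{obs}(s_n)=\mathbf q$. Then for every $t\in A$, if $\mathrm{Lim}_{\mathrm{obs}}(t)$ has a maximal element, this element is the greatest element of $\mathrm{Lim}_{\mathrm{obs}}(t)$.
   Context: A QARS is an abstract rewrite system $(A,\to)$ ($\to^*$ its reflexive–transitive closure) together with a map $\mathrm{obs}:A\to S$, where $(S,\le)$ is an $\omega$-complete partial order with a least element, such that $t\to s$ implies $\mathrm{obs}(t)\le\mathrm{obs}(s)$. An element is a normal form if it has no $\to$-successor. A maximal $\to$-sequence from $t$ is an infinite sequence $t=t_0,t_1,\dots$ such that for each $i$ either $t_i\to t_{i+1}$, or $t_i=t_{i+1}$ is a normal form. $\mathrm{Lim}_{\mathrm{obs}}(t)$ is the set of all $\sup_n\mathrm{obs}(t_n)$ for $\langle t_n\rangle$ a maximal $\to$-sequence from $t$. -}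

module Defs where

open import Level using (Level; _⊔_) renaming (suc to lsuc)
open import Data.Nat using (ℕ; zero; suc)
open import Data.Product using (Σ; _×_; _,_; ∃)
open import Data.Sum using (_⊎_)
open import Relation.Nullary using (¬_)
open import Relation.Binary using (Rel; Poset)
open import Relation.Binary.PropositionalEquality using (_≡_)
open import Relation.Binary.Construct.Closure.ReflexiveTransitive using (Star)

IsLub : ∀ {c ℓ₁ ℓ₂} (P : Poset c ℓ₁ ℓ₂) → (ℕ → Poset.Carrier P) → Poset.Carrier P → Set (c ⊔ ℓ₂)
IsLub P f p = (∀ n → f n ≤ p) × (∀ u → (∀ n → f n ≤ u) → p ≤ u)
  where open Poset P

record ωCPO (c ℓ₁ ℓ₂ : Level) : Set (lsuc (c ⊔ ℓ₁ ⊔ ℓ₂)) where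
  field
    poset : Poset c ℓ₁ ℓ₂
  open Poset poset public
  field
    ⊥        : Carrier
    ⊥-least  : ∀ x → ⊥ ≤ x
    sup      : (f : ℕ → Carrier) → (∀ n → f n ≤ f (suc n)) → Carrier
    sup-lub  : (f : ℕ → Carrier) (ch : ∀ n → f n ≤ f (suc n)) → IsLub poset f (sup f ch)

record QARS (a r c ℓ₁ ℓ₂ : Level) : Set (lsuc (a ⊔ r ⊔ c ⊔ ℓ₁ ⊔ ℓ₂)) where
  field
    A        : Set a
    _⟶_      : Rel A r
    S        : ωCPO c ℓ₁ ℓ₂
  open ωCPO S public using (Carrier; _≤_; _≈_; poset)
  field
    obs      : A → Carrier
    obs-mono : ∀ {t s} → t ⟶ s → obs t ≤ obs s

  _⟶*_ : Rel A (a ⊔ r)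
  _⟶*_ = Star _⟶_

  NormalForm : A → Set (a ⊔ r)
  NormalForm t = ¬ (∃ λ s → t ⟶ s)

  MaximalSeq : A → (ℕ → A) → Set (a ⊔ r)
  MaximalSeq t σ = (σ 0 ≡ t) ×
    (∀ i → (σ i ⟶ σ (suc i)) ⊎ ((σ i ≡ σ (suc i)) × NormalForm (σ i)))

  Lim : A → Carrier → Set (a ⊔ r ⊔ c ⊔ ℓ₂)
  Lim t p = Σ (ℕ → A) λ σ → MaximalSeq t σ × IsLub poset (λ n → obs (σ n)) p

  LimitProperty : Set (a ⊔ r ⊔ c ⊔ ℓ₂)
  LimitProperty = ∀ t s p → Lim t p → t ⟶* s →
    Σ Carrier λ q → Lim t q × p ≤ q × Lim s q

  IsMaximalIn-Lim : A → Carrier → Set (a ⊔ r ⊔ c ⊔ ℓ₁ ⊔ ℓ₂)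
  IsMaximalIn-Lim t m = Lim t m × (∀ q → Lim t q → m ≤ q → q ≈ m)

  IsGreatestIn-Lim : A → Carrier → Set (a ⊔ r ⊔ c ⊔ ℓ₂)
  IsGreatestIn-Lim t m = Lim t m × (∀ q → Lim t q → q ≤ m)

-- Every element reached from t along a maximal sequence σ is itself reachable
-- by ⟶* from t, so the Limit Property applied to the maximal element m gives
-- a limit q ≥ m of t realised by a sequence starting at σ n; maximality forces
-- q ≈ m, hence obs (σ n) ≤ m. Thus m bounds the observations of σ, and so
-- bounds their supremum.
module Submission where

open import Defs
open import Data.Nat using (zero; suc)
open import Data.Product using (_,_)
open import Data.Sum using (inj₁; inj₂)
open import Relation.Binary.PropositionalEquality using (refl; subst)
open import Relation.Binary.Construct.Closure.ReflexiveTransitive using (ε; _◅◅_; return)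

module _ {a r c ℓ₁ ℓ₂} (Q : QARS a r c ℓ₁ ℓ₂) where
  open QARS Q
  open ωCPO S using (reflexive; trans)

  maximalSeq-reachable : ∀ {t σ} → MaximalSeq t σ → ∀ n → t ⟶* σ n
  maximalSeq-reachable (refl , _) zero = ε
  maximalSeq-reachable {t} ms@(_ , steps) (suc n) with steps n
  ... | inj₁ step = maximalSeq-reachable ms n ◅◅ return step
  ... | inj₂ (same , _) = subst (t ⟶*_) same (maximalSeq-reachable ms n)

  Lim-obs-≤ : ∀ {t p} → Lim t p → obs t ≤ p
  Lim-obs-≤ (_ , (refl , _) , upper , _) = upper 0

  LimitProperty⇒reachable-obs-≤-maximal : LimitProperty →
    ∀ {t s m} → IsMaximalIn-Lim t m → t ⟶* s → obs s ≤ m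
  LimitProperty⇒reachable-obs-≤-maximal lp {t} {s} {m} (lim-m , maximal) t⟶*s
    with lp t s m lim-m t⟶*s
  ... | q , lim-q , m≤q , lim-s-q =
    trans (Lim-obs-≤ lim-s-q) (reflexive (maximal q lim-q m≤q))

mainTheorem3 : ∀ {a r c ℓ₁ ℓ₂} (Q : QARS a r c ℓ₁ ℓ₂) → QARS.LimitProperty Q →
    ∀ t m → QARS.IsMaximalIn-Lim Q t m → QARS.IsGreatestIn-Lim Q t m
mainTheorem3 Q lp t m max-m@(lim-m , _) = lim-m , greatest
  where
  open QARS Q
  greatest : ∀ q → Lim t q → q ≤ m
  greatest q (σ , ms , _ , least) = least m λ n →
    LimitProperty⇒reachable-obs-≤-maximal Q lp max-m (maximalSeq-reachable Q ms n)
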